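{- For any $k\in \mathbb N^*$, we have \begin{equation} \mathfrak m_k (3) \geq \overline{m} (k, \mathfrak A_3^{har}) \,. \end{equation}
   Context: For $N\in\mathbb N^*=\mathbb N\setminus\{0\}$, let $\mathfrak M(N)$ be the family of arrays $\mathfrak A=(a^n_i)$ with $N$ rows, each row an infinite strictly increasing sequence of reals. The spectrum of $\mathfrak A$ is the set of all sums $\lambda=\sum_{n=1}^N a^n_{j_n}$ with $(j_1,\dots,j_N)\in(\mathbb N^*)^N$, and the multiplicity of $\lambda$ is the number of such $N$-tuples representing it. Ordering the spectrum as a non-decreasing sequence $\lambda_1(\mathfrak A)\le\lambda_2(\mathfrak A)\le\dots$ counted with multiplicity, set $m(k,\mathfrak A)$ = multiplicity of $\lambda_k(\mathfrak A)$ and $\mathfrak m_k(N)=\sup_{\mathfrak A\in\mathfrak M(N)} m(k,\mathfrak A)$. $\mathfrak A_3^{har}$ is the array with three rows each equal to $0,1,2,3,\dots$; its eigenvalue $j\in\mathbb N$ has multiplicity $m(k_{min}(j),\mathfrak A_3^{har})=\frac{(j+1)(j+2)}{2}$ and smallest label $k_{min}(j)=1+\frac{j(j+1)(j+2)}{6}$. With $c(\ell)=\ell(\ell+1)/2$, for $j\in\mathbb N$, $\ell=0,\dots,j$ and $k\in\mathbb N^*$ in the interval $I_{j,\ell}=[k_{min}(j)+c(j+1)-c(j+1-\ell),\,k_{min}(j)+c(j+1)-c(j-\ell))$, define $\overline m(k,\mathfrak A_3^{har})=m(k_{min}(j),\mathfrak A_3^{har})+\ell=\frac{(j+1)(j+2)}{2}+\ell$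 (these intervals partition $\mathbb N^*$). -}

module Defs where

open import Data.Nat as ℕ using (ℕ; zero; suc; _∸_; _≤_)
open import Data.Nat.DivMod using (_/_)
open import Data.Fin as Fin using (Fin)
open import Data.Rational as ℚ using (ℚ; 0ℚ)
open import Data.Rational.Properties using (_<?_)
open import Data.Vec as Vec using (Vec; []; _∷_)
open import Data.List as List using (List; []; _∷_; upTo; concatMap; filter; length)
open import Data.List.Relation.Unary.All using (All)
open import Data.List.Relation.Unary.Unique.Propositional using (Unique)
open import Data.Unit using (⊤)
open import Data.Product using (Σ; ∃; _×_; _,_)
open import Relation.Binary.PropositionalEquality using (_≡_)

-- Rows are indexed from 0 (index i stands for the paper's index i+1).
Row : Set
Row = ℕ → ℚ

StrictlyIncreasing : Row → Set
StrictlyIncreasing f = ∀ i → f i ℚ.< f (suc i)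

Array : ℕ → Set
Array N = Fin N → Row

InM : ∀ N → Array N → Set
InM N A = ∀ n → StrictlyIncreasing (A n)

Tuple : ℕ → Set
Tuple N = Vec ℕ N

spec : ∀ {N} → Array N → Tuple N → ℚ
spec {zero}  A []      = 0ℚ
spec {suc N} A (j ∷ t) = A Fin.zero j ℚ.+ spec (λ n → A (Fin.suc n)) t

box : ∀ N → ℕ → List (Tuple N)
box zero    B = [] ∷ []
box (suc N) B = concatMap (λ j → List.map (j ∷_) (box N B)) (upTo B)

AllBelow : ∀ {N} → ℕ → Tuple N → Set
AllBelow B []      = ⊤
AllBelow B (j ∷ t) = (j ℕ.< B) × AllBelow B t

-- #{ tuples t : spec A t < λ } = n  (in particular this set is finite)
CountBelow : ∀ {N} → Array N → ℚ → ℕ → Set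
CountBelow {N} A v n =
  Σ ℕ λ B → (∀ (t : Tuple N) → spec A t ℚ.< v → AllBelow B t)
          × length (filter (λ t → spec A t <? v) (box N B)) ≡ n

MultAtLeast : ∀ {N} → Array N → ℚ → ℕ → Set
MultAtLeast {N} A v M =
  Σ (List (Tuple N)) λ ts → length ts ≡ M × Unique ts × All (λ t → spec A t ≡ v) ts

-- "m(k,𝔄) ≥ M": λ_k(𝔄) = λ (i.e. #{<λ} < k ≤ #{≤λ}, counted with
-- multiplicity) and the multiplicity of λ is at least M.
LabelMultAtLeast : ∀ {N} → Array N → ℕ → ℕ → Set
LabelMultAtLeast A k M =
  Σ ℚ λ v → Σ ℕ λ n< → CountBelow A v n< × n< ℕ.< k
           × MultAtLeast A v (k ∸ n<) × MultAtLeast A v M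

-- "𝔪_k(N) ≥ M": the supremum over 𝔐(N) of m(k,𝔄) is at least M
-- (a supremum of naturals in ℕ ∪ {∞} is ≥ M iff some member is ≥ M).
SupMultAtLeast : ℕ → ℕ → ℕ → Set
SupMultAtLeast N k M = Σ (Array N) λ A → InM N A × LabelMultAtLeast A k M

kmin : ℕ → ℕ
kmin j = suc ((j ℕ.* suc j ℕ.* suc (suc j)) / 6)

c : ℕ → ℕ
c l = (l ℕ.* suc l) / 2

multHar : ℕ → ℕ
multHar j = (suc j ℕ.* suc (suc j)) / 2

Ilo : ℕ → ℕ → ℕ
Ilo j l = (kmin j ℕ.+ c (suc j)) ∸ c (suc j ∸ l)

Ihi : ℕ → ℕ → ℕ
Ihi j l = (kmin j ℕ.+ c (suc j)) ∸ c (j ∸ l)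

InI : ℕ → ℕ → ℕ → Set
InI j l k = (l ≤ j) × (Ilo j l ≤ k) × (k ℕ.< Ihi j l)

MbarHar : ℕ → ℕ → Set
MbarHar k M = Σ ℕ λ j → Σ ℕ λ l → InI j l k × M ≡ multHar j ℕ.+ l

{-# OPTIONS --safe #-}
module Submission where

-- The witness is the harmonic array 𝔄₃^har with the single value ℓ deleted from its
-- first row. The new first row enumerates ℕ ∖ {ℓ} (as punchIn does for Fin), so the
-- tuples lost are exactly those whose first entry would have been ℓ: the number of
-- tuples of weight < n drops from simplicial 3 n to simplicial 3 n − simplicial 2 (n − ℓ),
-- where simplicial N n is the number of N-tuples of naturals with sum < n. Comparing the thresholds n = j + 1 and n = j + 2 shows that
-- the eigenvalue j + 1 has multiplicity (j+1)(j+2)/2 + ℓ and that its labels form an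
-- interval containing I_{j,ℓ}.

open import Defs
open import Data.Nat using (ℕ; _≥_)

open import Data.Nat.Properties
open import Algebra.Properties.CommutativeMonoid.Sum +-0-commutativeMonoid
  using (sum-syntax; sum-remove; sum-init-last; sum-cong-≗; sum-replicate-zero)
open import Algebra.Properties.CommutativeSemigroup +-commutativeSemigroup
  using (interchange; x∙yz≈xz∙y)
open import Data.Bool.Base using (true; false)
import Data.Integer.Base as ℤ
import Data.Integer.Properties as ℤP
open import Data.Fin.Base as F using (Fin; toℕ; punchIn; fromℕ<)
open import Data.Fin.Properties using (toℕ<n; toℕ-inject₁; toℕ-fromℕ; toℕ-fromℕ<)
open import Data.List.Base
  using (List; []; _∷_; map; concatMap; applyUpTo; filter; length; take)
open import Data.List.Properties
  using (filter-++; length-++; filter-≐; filter-none; filter-accept; filter-reject; length-take)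
open import Data.List.Membership.Propositional using (_∈_)
open import Data.List.Membership.Propositional.Properties using (∈-map⁻)
open import Data.List.Relation.Unary.All using (All; []; _∷_; universal)
import Data.List.Relation.Unary.All.Properties as AllP
open import Data.List.Relation.Unary.AllPairs as AllPairs using ([]; _∷_)
import Data.List.Relation.Unary.AllPairs.Properties as AllPairsP
open import Data.List.Relation.Unary.Unique.Propositional using (Unique)
import Data.List.Relation.Unary.Unique.Propositional.Properties as UniqueP
open import Data.Nat.Base using (zero; suc; _+_; _*_; _∸_; _≤_; _<_; z≤n; s≤s; s≤s⁻¹)
open import Data.Nat.DivMod using (_/_; m*n/n≡m)
open import Data.Nat.Tactic.RingSolver using (solve-∀)
open import Data.Product using (_,_; _×_)
open import Data.Rational.Base as ℚ using (ℚ)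
open import Data.Rational.Literals using (fromℤ)
import Data.Rational.Properties as ℚP
open import Data.Unit using (tt)
open import Data.Vec.Base using ([]; _∷_)
import Data.Vec.Properties as VecP
open import Function using (_∘_; id)
open import Relation.Binary.Definitions using (tri<; tri≈; tri>)
open import Relation.Binary.PropositionalEquality
open import Relation.Nullary using (¬_; does)
open import Relation.Unary using (Decidable)

fromℕ : ℕ → ℚ
fromℕ n = fromℤ (ℤ.+ n)

fromℕ-+ : ∀ m n → fromℕ m ℚ.+ fromℕ n ≡ fromℕ (m + n)
fromℕ-+ m n =
  trans (cong (ℚ._/ 1) (cong₂ ℤ._+_ (ℤP.*-identityʳ (ℤ.+ m)) (ℤP.*-identityʳ (ℤ.+ n))))
        (ℚP.normalize-coprime {m + n} {0} _)

fromℕ-mono-< : ∀ {m n} → m < n → fromℕ m ℚ.< fromℕ n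
fromℕ-mono-< {m} {n} m<n =
  ℚ.*<* (subst₂ ℤ._<_ (sym (ℤP.*-identityʳ (ℤ.+ m))) (sym (ℤP.*-identityʳ (ℤ.+ n)))
                      (ℤ.+<+ m<n))

fromℕ-cancel-< : ∀ {m n} → fromℕ m ℚ.< fromℕ n → m < n
fromℕ-cancel-< {m} {n} p =
  ℤP.drop‿+<+ (subst₂ ℤ._<_ (ℤP.*-identityʳ (ℤ.+ m)) (ℤP.*-identityʳ (ℤ.+ n))
                            (ℚP.drop-*<* p))

fromℕ-injective : ∀ {m n} → fromℕ m ≡ fromℕ n → m ≡ n
fromℕ-injective = cong (ℤ.∣_∣ ∘ ℚ.ℚ.numerator)

m+n<o⇒n<o∸m : ∀ m {n o} → m + n < o → n < o ∸ m
m+n<o⇒n<o∸m zero    p                   = p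
m+n<o⇒n<o∸m (suc m) {o = suc o} (s≤s p) = m+n<o⇒n<o∸m m p

n<o∸m⇒m+n<o : ∀ m {n o} → n < o ∸ m → m + n < o
n<o∸m⇒m+n<o zero    p               = p
n<o∸m⇒m+n<o (suc m) {o = zero}  ()
n<o∸m⇒m+n<o (suc m) {o = suc o} p = s≤s (n<o∸m⇒m+n<o m p)

length-filter-<-suc : ∀ {A : Set} (f : A → ℕ) n xs →
  length (filter (λ x → f x <? suc n) xs) ≡
  length (filter (λ x → f x <? n) xs) + length (filter (λ x → f x ≟ n) xs)
length-filter-<-suc f n []       = refl
length-filter-<-suc f n (x ∷ xs) with <-cmp (f x) n
... | tri< fx<n fx≢n _
  rewrite filter-accept (λ y → f y <? suc n) {xs = xs} (m≤n⇒m≤1+n fx<n)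
        | filter-accept (λ y → f y <? n) {xs = xs} fx<n
        | filter-reject (λ y → f y ≟ n) {xs = xs} fx≢n
  = cong suc (length-filter-<-suc f n xs)
... | tri≈ fx≮n fx≡n _
  rewrite filter-accept (λ y → f y <? suc n) {xs = xs} (s≤s (≤-reflexive fx≡n))
        | filter-reject (λ y → f y <? n) {xs = xs} fx≮n
        | filter-accept (λ y → f y ≟ n) {xs = xs} fx≡n
  = trans (cong suc (length-filter-<-suc f n xs)) (sym (+-suc _ _))
... | tri> fx≮n fx≢n n<fx
  rewrite filter-reject (λ y → f y <? suc n) {xs = xs} (<⇒≱ n<fx ∘ s≤s⁻¹)
        | filter-reject (λ y → f y <? n) {xs = xs} fx≮n
        | filter-reject (λ y → f y ≟ n) {xs = xs} fx≢n
  = length-filter-<-suc f n xs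

length-filter-concatMap : ∀ {A C : Set} {P : C → Set} (P? : Decidable P)
                          (f : A → List C) (h : ℕ → A) n →
  length (filter P? (concatMap f (applyUpTo h n)))
    ≡ ∑[ i < n ] length (filter P? (f (h (toℕ i))))
length-filter-concatMap P? f h zero    = refl
length-filter-concatMap P? f h (suc n) =
  trans (cong length (filter-++ P? (f (h 0)) (concatMap f (applyUpTo (h ∘ suc) n))))
  (trans (length-++ (filter P? (f (h 0))))
         (cong (length (filter P? (f (h 0))) +_) (length-filter-concatMap P? f (h ∘ suc) n)))

length-filter-map : ∀ {A C : Set} {P : C → Set} (P? : Decidable P) (f : A → C) xs →
  length (filter P? (map f xs)) ≡ length (filter (P? ∘ f) xs)
length-filter-map P? f []       = refl
length-filter-map P? f (x ∷ xs) with does (P? (f x))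
... | true  = cong suc (length-filter-map P? f xs)
... | false = length-filter-map P? f xs

∑-snoc : ∀ (f : ℕ → ℕ) n → ∑[ i < suc n ] f (toℕ i) ≡ ∑[ i < n ] f (toℕ i) + f n
∑-snoc f n =
  trans (sum-init-last (f ∘ toℕ))
        (cong₂ _+_ (sum-cong-≗ {n} (cong f ∘ toℕ-inject₁)) (cong f (toℕ-fromℕ n)))

∑-reverse : ∀ (f : ℕ → ℕ) → f 0 ≡ 0 → ∀ {n B} → n ≤ B →
            ∑[ x < B ] f (n ∸ toℕ x) ≡ ∑[ i < n ] f (suc (toℕ i))
∑-reverse f f0 {zero}  {B}     _         =
  trans (sum-cong-≗ {B} λ x → trans (cong f (0∸n≡0 (toℕ x))) f0) (sum-replicate-zero B)
∑-reverse f f0 {suc n} {suc B} (s≤s n≤B) = begin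
  f (suc n) + ∑[ x < B ] f (n ∸ toℕ x)    ≡⟨ cong (f (suc n) +_) (∑-reverse f f0 n≤B) ⟩
  f (suc n) + ∑[ i < n ] f (suc (toℕ i))  ≡⟨ +-comm (f (suc n)) _ ⟩
  ∑[ i < n ] f (suc (toℕ i)) + f (suc n)  ≡⟨ ∑-snoc (f ∘ suc) n ⟨
  ∑[ i < suc n ] f (suc (toℕ i))          ∎
  where open ≡-Reasoning

NatArray : ℕ → Set
NatArray N = Fin N → ℕ → ℕ

toArray : ∀ {N} → NatArray N → Array N
toArray R n i = fromℕ (R n i)

weight : ∀ {N} → NatArray N → Tuple N → ℕ
weight R []      = 0
weight R (j ∷ t) = R F.zero j + weight (R ∘ F.suc) t

spec-toArray : ∀ {N} (R : NatArray N) t → spec (toArray R) t ≡ fromℕ (weight R t)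
spec-toArray R []      = refl
spec-toArray R (j ∷ t) =
  trans (cong (fromℕ (R F.zero j) ℚ.+_) (spec-toArray (R ∘ F.suc) t))
        (fromℕ-+ (R F.zero j) _)

toArray-InM : ∀ {N} (R : NatArray N) → (∀ n i → R n i < R n (suc i)) → InM N (toArray R)
toArray-InM R R-< n i = fromℕ-mono-< (R-< n i)

allBelow-weight : ∀ {N} (R : NatArray N) → (∀ n i → i ≤ R n i) →
                  ∀ {B} t → weight R t < B → AllBelow B t
allBelow-weight R i≤R []      _   = tt
allBelow-weight R i≤R (j ∷ t) w<B =
  ≤-<-trans (≤-trans (i≤R F.zero j) (m≤m+n _ _)) w<B ,
  allBelow-weight (R ∘ F.suc) (i≤R ∘ F.suc) t (≤-<-trans (m≤n+m _ _) w<B)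

allBelow-spec : ∀ {N} (R : NatArray N) → (∀ n i → i ≤ R n i) →
                ∀ {n B} → n ≤ B → ∀ t → spec (toArray R) t ℚ.< fromℕ n → AllBelow B t
allBelow-spec R i≤R n≤B t p =
  allBelow-weight R i≤R t
    (≤-trans (fromℕ-cancel-< (subst (ℚ._< _) (spec-toArray R t) p)) n≤B)

box-unique : ∀ N B → Unique (box N B)
box-unique zero    B = [] ∷ []
box-unique (suc N) B =
  UniqueP.concat⁺ (columns (applyUpTo id B))
                  (AllPairsP.map⁺ (AllPairs.map disjoint (UniqueP.upTo⁺ B)))
  where
  columns : ∀ xs → All Unique (map (λ j → map (j ∷_) (box N B)) xs)
  columns []       = []
  columns (x ∷ xs) = UniqueP.map⁺ VecP.∷-injectiveʳ (box-unique N B) ∷ columns xs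
  disjoint : ∀ {x y} → x ≢ y →
             ∀ {t} → ¬ (t ∈ map (x ∷_) (box N B) × t ∈ map (y ∷_) (box N B))
  disjoint x≢y (t∈x , t∈y) with ∈-map⁻ (_ ∷_) t∈x | ∈-map⁻ (_ ∷_) t∈y
  ... | _ , _ , refl | _ , _ , eq = x≢y (VecP.∷-injectiveˡ eq)

module _ {N} (A : Array N) (v : ℚ) (B : ℕ) where

  lower : List (Tuple N)
  lower = filter (λ t → spec A t ℚP.<? v) (box N B)

  level : List (Tuple N)
  level = filter (λ t → spec A t ℚP.≟ v) (box N B)

  multAtLeast-level : ∀ {m} → m ≤ length level → MultAtLeast A v m
  multAtLeast-level {m} m≤ =
    take m level ,
    trans (length-take m level) (m≤n⇒m⊓n≡m m≤) ,
    UniqueP.take⁺ m (UniqueP.filter⁺ _ (box-unique N B)) ,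
    AllP.take⁺ m (AllP.all-filter _ (box N B))

  labelMultAtLeast-box : ∀ {k M b e} → (∀ t → spec A t ℚ.< v → AllBelow B t) →
    length lower ≡ b → length level ≡ e → b < k × k ≤ b + e → M ≤ e →
    LabelMultAtLeast A k M
  labelMultAtLeast-box inBox refl refl (b<k , k≤b+e) M≤e =
    v , length lower , (B , inBox , refl) , b<k ,
    multAtLeast-level (m≤n+o⇒m∸n≤o _ _ k≤b+e) , multAtLeast-level M≤e

#below : ∀ {N} → NatArray N → ℕ → ℕ → ℕ
#below {N} R B n = length (filter (λ t → weight R t <? n) (box N B))

#at : ∀ {N} → NatArray N → ℕ → ℕ → ℕ
#at {N} R B n = length (filter (λ t → weight R t ≟ n) (box N B))

length-lower : ∀ {N} (R : NatArray N) B n →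
               length (lower (toArray R) (fromℕ n) B) ≡ #below R B n
length-lower {N} R B n = cong length (filter-≐ _ _ (to , from) (box N B))
  where
  to : ∀ {t} → spec (toArray R) t ℚ.< fromℕ n → weight R t < n
  to {t} p = fromℕ-cancel-< (subst (ℚ._< fromℕ n) (spec-toArray R t) p)
  from : ∀ {t} → weight R t < n → spec (toArray R) t ℚ.< fromℕ n
  from {t} p = subst (ℚ._< fromℕ n) (sym (spec-toArray R t)) (fromℕ-mono-< p)

length-level : ∀ {N} (R : NatArray N) B n →
               length (level (toArray R) (fromℕ n) B) ≡ #at R B n
length-level {N} R B n = cong length (filter-≐ _ _ (to , from) (box N B))
  where
  to : ∀ {t} → spec (toArray R) t ≡ fromℕ n → weight R t ≡ n
  to {t} p = fromℕ-injective (trans (sym (spec-toArray R t)) p)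
  from : ∀ {t} → weight R t ≡ n → spec (toArray R) t ≡ fromℕ n
  from {t} p = trans (spec-toArray R t) (cong fromℕ p)

#below-suc : ∀ {N} (R : NatArray N) B n → #below R B (suc n) ≡ #below R B n + #at R B n
#below-suc {N} R B n = length-filter-<-suc (weight R) n (box N B)

#below-zero : ∀ {N} (R : NatArray N) B → #below R B 0 ≡ 0
#below-zero {N} R B = cong length (filter-none _ (universal (λ _ ()) (box N B)))

#below-cons : ∀ {N} (R : NatArray (suc N)) B n →
  #below R B n ≡ ∑[ x < B ] #below (R ∘ F.suc) B (n ∸ R F.zero (toℕ x))
#below-cons {N} R B n =
  trans (length-filter-concatMap below? (λ j → map (j ∷_) (box N B)) id B)
        (sum-cong-≗ {B} (column ∘ toℕ))
  where
  below? : Decidable (λ t → weight R t < n)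
  below? t = weight R t <? n
  column : ∀ j → length (filter below? (map (j ∷_) (box N B)))
                   ≡ #below (R ∘ F.suc) B (n ∸ R F.zero j)
  column j =
    trans (length-filter-map below? (j ∷_) (box N B))
          (cong length (filter-≐ (below? ∘ (j ∷_))
                                 (λ t → weight (R ∘ F.suc) t <? n ∸ R F.zero j)
                                 (m+n<o⇒n<o∸m (R F.zero j) , n<o∸m⇒m+n<o (R F.zero j))
                                 (box N B)))

simplicial : ℕ → ℕ → ℕ
simplicial zero    zero    = 0
simplicial zero    (suc _) = 1
simplicial (suc N) n       = ∑[ i < n ] simplicial N (suc (toℕ i))

simplicial-suc : ∀ N n →
                 simplicial (suc N) (suc n) ≡ simplicial (suc N) n + simplicial N (suc n)
simplicial-suc N = ∑-snoc (simplicial N ∘ suc)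

simplicial-1 : ∀ n → simplicial 1 n ≡ n
simplicial-1 zero    = refl
simplicial-1 (suc n) = cong suc (simplicial-1 n)

simplicial-2-suc : ∀ n → simplicial 2 (suc n) ≡ simplicial 2 n + suc n
simplicial-2-suc n = trans (simplicial-suc 1 n) (cong (simplicial 2 n +_) (simplicial-1 (suc n)))

n≤simplicial-2 : ∀ n → n ≤ simplicial 2 n
n≤simplicial-2 zero    = z≤n
n≤simplicial-2 (suc n) =
  subst (suc n ≤_) (sym (simplicial-2-suc n)) (m≤n+m (suc n) (simplicial 2 n))

simplicial-2 : ∀ n → simplicial 2 n * 2 ≡ n * suc n
simplicial-2 zero    = refl
simplicial-2 (suc n) = begin
  simplicial 2 (suc n) * 2         ≡⟨ cong (_* 2) (simplicial-2-suc n) ⟩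
  (simplicial 2 n + suc n) * 2     ≡⟨ *-distribʳ-+ 2 (simplicial 2 n) (suc n) ⟩
  simplicial 2 n * 2 + suc n * 2   ≡⟨ cong (_+ suc n * 2) (simplicial-2 n) ⟩
  n * suc n + suc n * 2            ≡⟨ pascal n ⟩
  suc n * suc (suc n)              ∎
  where
  open ≡-Reasoning
  pascal : ∀ m → m * suc m + suc m * 2 ≡ suc m * suc (suc m)
  pascal = solve-∀

simplicial-3 : ∀ n → simplicial 3 n * 6 ≡ n * suc n * suc (suc n)
simplicial-3 zero    = refl
simplicial-3 (suc n) = begin
  simplicial 3 (suc n) * 6
    ≡⟨ cong (_* 6) (simplicial-suc 2 n) ⟩
  (simplicial 3 n + simplicial 2 (suc n)) * 6
    ≡⟨ *-distribʳ-+ 6 (simplicial 3 n) _ ⟩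
  simplicial 3 n * 6 + simplicial 2 (suc n) * 6
    ≡⟨ cong (simplicial 3 n * 6 +_) (*-assoc (simplicial 2 (suc n)) 2 3) ⟨
  simplicial 3 n * 6 + simplicial 2 (suc n) * 2 * 3
    ≡⟨ cong₂ (λ a b → a + b * 3) (simplicial-3 n) (simplicial-2 (suc n)) ⟩
  n * suc n * suc (suc n) + suc n * suc (suc n) * 3
    ≡⟨ pascal n ⟩
  suc n * suc (suc n) * suc (suc (suc n))
    ∎
  where
  open ≡-Reasoning
  pascal : ∀ m → m * suc m * suc (suc m) + suc m * suc (suc m) * 3
                 ≡ suc m * suc (suc m) * suc (suc (suc m))
  pascal = solve-∀

harmonic : ∀ N → NatArray N
harmonic N _ = id

#below-harmonic : ∀ N {B n} → n ≤ B → #below (harmonic N) B n ≡ simplicial N n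
∑-#below-harmonic : ∀ N {B B′ n} → n ≤ B → n ≤ B′ →
                    ∑[ x < B′ ] #below (harmonic N) B (n ∸ toℕ x) ≡ simplicial (suc N) n

#below-harmonic zero    {n = zero}  _   = refl
#below-harmonic zero    {n = suc n} _   = refl
#below-harmonic (suc N) {B} {n}     n≤B =
  trans (#below-cons (harmonic (suc N)) B n) (∑-#below-harmonic N n≤B n≤B)

∑-#below-harmonic N {B} {B′} {n} n≤B n≤B′ =
  trans (∑-reverse (#below (harmonic N) B) (#below-zero (harmonic N) B) n≤B′)
        (sum-cong-≗ {n} λ i → #below-harmonic N (≤-trans (toℕ<n i) n≤B))

skip : ℕ → ℕ → ℕ
skip zero    i       = suc i
skip (suc l) zero    = zero
skip (suc l) (suc i) = suc (skip l i)

skip-< : ∀ l i → skip l i < skip l (suc i)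
skip-< zero    i       = n<1+n (suc i)
skip-< (suc l) zero    = s≤s z≤n
skip-< (suc l) (suc i) = s≤s (skip-< l i)

i≤skip : ∀ l i → i ≤ skip l i
i≤skip zero    i       = n≤1+n i
i≤skip (suc l) zero    = z≤n
i≤skip (suc l) (suc i) = s≤s (i≤skip l i)

toℕ-punchIn : ∀ {n} (l : Fin (suc n)) i → toℕ (punchIn l i) ≡ skip (toℕ l) (toℕ i)
toℕ-punchIn F.zero    i         = refl
toℕ-punchIn (F.suc l) F.zero    = refl
toℕ-punchIn (F.suc l) (F.suc i) = cong suc (toℕ-punchIn l i)

skipping : ∀ N → ℕ → NatArray (suc N)
skipping N l F.zero    = skip l
skipping N l (F.suc _) = id

skipping-< : ∀ {N} l n i → skipping N l n i < skipping N l n (suc i)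
skipping-< l F.zero    i = skip-< l i
skipping-< l (F.suc _) i = n<1+n i

i≤skipping : ∀ {N} l n i → i ≤ skipping N l n i
i≤skipping l F.zero    i = i≤skip l i
i≤skipping l (F.suc _) i = ≤-refl

#below-skipping : ∀ N {B l n} → l ≤ B → n ≤ B →
                  #below (skipping N l) B n + simplicial N (n ∸ l) ≡ simplicial (suc N) n
#below-skipping N {B} {l} {n} l≤B n≤B = begin
  #below (skipping N l) B n + simplicial N (n ∸ l)
    ≡⟨ cong₂ _+_ (#below-cons (skipping N l) B n)
                 (sym (#below-harmonic N (≤-trans (m∸n≤m n l) n≤B))) ⟩
  ∑[ x < B ] F (n ∸ skip l (toℕ x)) + F (n ∸ l)
    ≡⟨ cong₂ _+_ (sum-cong-≗ {B} λ x → cong (λ m → F (n ∸ m)) (toℕ-punchIn-l′ x))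
                 (cong (λ m → F (n ∸ m)) (toℕ-fromℕ< (s≤s l≤B))) ⟨
  ∑[ x < B ] G (punchIn l′ x) + G l′
    ≡⟨ +-comm _ (G l′) ⟩
  G l′ + ∑[ x < B ] G (punchIn l′ x)
    ≡⟨ sum-remove {i = l′} G ⟨
  ∑[ y < suc B ] F (n ∸ toℕ y)
    ≡⟨ ∑-#below-harmonic N n≤B (m≤n⇒m≤1+n n≤B) ⟩
  simplicial (suc N) n ∎
  where
  open ≡-Reasoning
  F : ℕ → ℕ
  F = #below (harmonic N) B
  G : Fin (suc B) → ℕ
  G y = F (n ∸ toℕ y)
  l′ : Fin (suc B)
  l′ = fromℕ< (s≤s l≤B)
  toℕ-punchIn-l′ : ∀ x → toℕ (punchIn l′ x) ≡ skip l (toℕ x)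
  toℕ-punchIn-l′ x =
    trans (toℕ-punchIn l′ x) (cong (λ m → skip m (toℕ x)) (toℕ-fromℕ< (s≤s l≤B)))

#at-skipping : ∀ N {B l n} → l ≤ n → suc n ≤ B →
               #at (skipping (suc N) l) B n + simplicial N (suc n ∸ l)
                 ≡ simplicial (suc N) (suc n)
#at-skipping N {B} {l} {n} l≤n n<B = +-cancelˡ-≡ (below n + S (suc N) (n ∸ l)) _ _ (begin
  (below n + S (suc N) (n ∸ l)) + (#at R B n + S N (suc n ∸ l))
    ≡⟨ interchange (below n) _ _ _ ⟩
  (below n + #at R B n) + (S (suc N) (n ∸ l) + S N (suc n ∸ l))
    ≡⟨ cong₂ _+_ (#below-suc R B n) simplicial-∸-suc ⟨
  below (suc n) + S (suc N) (suc n ∸ l)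
    ≡⟨ #below-skipping (suc N) l≤B n<B ⟩
  S (suc (suc N)) (suc n)
    ≡⟨ simplicial-suc (suc N) n ⟩
  S (suc (suc N)) n + S (suc N) (suc n)
    ≡⟨ cong (_+ S (suc N) (suc n)) (#below-skipping (suc N) l≤B (<⇒≤ n<B)) ⟨
  (below n + S (suc N) (n ∸ l)) + S (suc N) (suc n) ∎)
  where
  open ≡-Reasoning
  S : ℕ → ℕ → ℕ
  S = simplicial
  R : NatArray (suc (suc N))
  R = skipping (suc N) l
  below : ℕ → ℕ
  below = #below R B
  l≤B : l ≤ B
  l≤B = ≤-trans l≤n (<⇒≤ n<B)
  simplicial-∸-suc : S (suc N) (suc n ∸ l) ≡ S (suc N) (n ∸ l) + S N (suc n ∸ l)
  simplicial-∸-suc rewrite +-∸-assoc 1 l≤n = simplicial-suc N (n ∸ l)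

#at-skipping-2 : ∀ {B l n} → l ≤ n → suc n ≤ B →
                 #at (skipping 2 l) B n ≡ simplicial 2 n + l
#at-skipping-2 {B} {l} {n} l≤n n<B = +-cancelʳ-≡ (suc n ∸ l) _ _ (begin
  #at R B n + (suc n ∸ l)               ≡⟨ cong (#at R B n +_) (simplicial-1 (suc n ∸ l)) ⟨
  #at R B n + simplicial 1 (suc n ∸ l)  ≡⟨ #at-skipping 1 l≤n n<B ⟩
  simplicial 2 (suc n)                  ≡⟨ simplicial-2-suc n ⟩
  simplicial 2 n + suc n                ≡⟨ cong (simplicial 2 n +_) (m+[n∸m]≡n l≤1+n) ⟨
  simplicial 2 n + (l + (suc n ∸ l))    ≡⟨ +-assoc (simplicial 2 n) l _ ⟨
  simplicial 2 n + l + (suc n ∸ l)      ∎)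
  where
  open ≡-Reasoning
  R : NatArray 3
  R = skipping 2 l
  l≤1+n : l ≤ suc n
  l≤1+n = m≤n⇒m≤1+n l≤n

c-simplicial : ∀ n → c n ≡ simplicial 2 n
c-simplicial n = trans (cong (_/ 2) (sym (simplicial-2 n))) (m*n/n≡m (simplicial 2 n) 2)

kmin-simplicial : ∀ j → kmin j ≡ suc (simplicial 3 j)
kmin-simplicial j =
  cong suc (trans (cong (_/ 6) (sym (simplicial-3 j))) (m*n/n≡m (simplicial 3 j) 6))

kmin+c : ∀ j → kmin j + c (suc j) ≡ suc (simplicial 3 (suc j))
kmin+c j = trans (cong₂ _+_ (kmin-simplicial j) (c-simplicial (suc j)))
                 (cong suc (sym (simplicial-suc 2 j)))

Ilo-simplicial : ∀ {j l b} → b + simplicial 2 (suc j ∸ l) ≡ simplicial 3 (suc j) →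
                 Ilo j l ≡ suc b
Ilo-simplicial {j} {l} {b} eq = begin
  (kmin j + c (suc j)) ∸ c (suc j ∸ l)
    ≡⟨ cong₂ _∸_ (trans (kmin+c j) (cong suc (sym eq))) (c-simplicial (suc j ∸ l)) ⟩
  suc b + simplicial 2 (suc j ∸ l) ∸ simplicial 2 (suc j ∸ l)
    ≡⟨ m+n∸n≡m (suc b) (simplicial 2 (suc j ∸ l)) ⟩
  suc b ∎
  where open ≡-Reasoning

Ihi-simplicial : ∀ {j l b} → l ≤ j → b + simplicial 2 (suc j ∸ l) ≡ simplicial 3 (suc j) →
                 Ihi j l ≡ suc (b + suc (j ∸ l))
Ihi-simplicial {j} {l} {b} l≤j eq = begin
  (kmin j + c (suc j)) ∸ c (j ∸ l)
    ≡⟨ cong₂ _∸_ (trans (kmin+c j) (cong suc (sym eq))) (c-simplicial (j ∸ l)) ⟩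
  suc (b + simplicial 2 (suc j ∸ l)) ∸ simplicial 2 (j ∸ l)
    ≡⟨ cong (λ m → suc (b + m) ∸ simplicial 2 (j ∸ l)) simplicial-2-∸-suc ⟩
  suc (b + (simplicial 2 (j ∸ l) + suc (j ∸ l))) ∸ simplicial 2 (j ∸ l)
    ≡⟨ cong (λ m → suc m ∸ simplicial 2 (j ∸ l)) (x∙yz≈xz∙y b _ _) ⟩
  suc (b + suc (j ∸ l)) + simplicial 2 (j ∸ l) ∸ simplicial 2 (j ∸ l)
    ≡⟨ m+n∸n≡m (suc (b + suc (j ∸ l))) (simplicial 2 (j ∸ l)) ⟩
  suc (b + suc (j ∸ l)) ∎
  where
  open ≡-Reasoning
  simplicial-2-∸-suc : simplicial 2 (suc j ∸ l) ≡ simplicial 2 (j ∸ l) + suc (j ∸ l)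
  simplicial-2-∸-suc rewrite +-∸-assoc 1 l≤j = simplicial-2-suc (j ∸ l)

InI⇒label-range : ∀ {j l k b} → InI j l k →
                  b + simplicial 2 (suc j ∸ l) ≡ simplicial 3 (suc j) →
                  b < k × k ≤ b + (simplicial 2 (suc j) + l)
InI⇒label-range {j} {l} {k} {b} (l≤j , Ilo≤k , k<Ihi) eq =
  subst (_≤ k) (Ilo-simplicial {j} {l} eq) Ilo≤k ,
  ≤-trans (s≤s⁻¹ (subst (k <_) (Ihi-simplicial {j} {l} l≤j eq) k<Ihi))
          (+-monoʳ-≤ b width≤multiplicity)
  where
  width≤multiplicity : suc (j ∸ l) ≤ simplicial 2 (suc j) + l
  width≤multiplicity =
    ≤-trans (s≤s (m∸n≤m j l)) (≤-trans (n≤simplicial-2 (suc j)) (m≤m+n _ l))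

theorem7p1 : (k : ℕ) → k ≥ 1 → (M : ℕ) → MbarHar k M → SupMultAtLeast 3 k M
theorem7p1 k _ M (j , l , k∈I@(l≤j , _) , refl) =
  toArray R , toArray-InM R (skipping-< l) ,
  labelMultAtLeast-box (toArray R) (fromℕ (suc j)) B
    (allBelow-spec R (i≤skipping l) (n≤1+n (suc j)))
    (length-lower R B (suc j))
    (trans (length-level R B (suc j)) (#at-skipping-2 {B} (m≤n⇒m≤1+n l≤j) ≤-refl))
    (InI⇒label-range k∈I (#below-skipping 2 {B} l≤B (n≤1+n (suc j))))
    (≤-reflexive (cong (_+ l) (c-simplicial (suc j))))
  where
  R : NatArray 3
  R = skipping 2 l
  B : ℕ
  B = suc (suc j)
  l≤B : l ≤ B
  l≤B = m≤n⇒m≤1+n (m≤n⇒m≤1+n l≤j)
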